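{- Let $\alpha\in\{+,-\}$ and let $G_1$ and $G_2$ be almost strong $\alpha$-radials with root $r$ such that $V(G_1)\cap V(G_2)=\{r\}$. Then $G_1+G_2$ is an almost strong $\alpha$-radial with root $r$.
   Context: A bidirected graph $G$ is a finite graph (loops and parallel edges allowed) with maps $\partial_+,\partial_-:E(G)\to 2^{V(G)}$ such that for each edge $e$ with (possibly identical) ends $u,v$: $\partial_\alpha(e)\subseteq\{u,v\}$, $\partial_+(e)\cup\partial_-(e)=\{u,v\}$, and $\partial_+(e)\cap\partial_-(e)=\emptyset$ if $e$ is not a loop. If $u\in\partial_\alpha(e)$, the sign of $u$ over $e$ is $\alpha$; $-\alpha$ denotes the opposite sign. $G_1+G_2$ is the union of the two bidirected graphs (vertices and edges). A walk is a sequence $W=(w_1,\dots,w_k)$, $k$ odd, with $w_i$ a vertex for odd $i$ and $w_i$ an edge joining $w_{i-1},w_{i+1}$ for even $i$; closed over $r$ if $w_1=w_k=r$; a trail has no repeated edge. $W$ is a diwalk if to each traversal of an edge $w_i$ one can assign signs to its end-occurrences equal to the signs of these vertices over $w_i$ (for a loop with one end $+$ and one end $-$, the two assigned signs are distinct), such that at every internal vertex term the signs assigned from the preceding and following edges are distinct. A ditrail is a diwalk that is a trail. For $k\ge3$ the sign of $w_1$ (resp. $w_k$) over $W$ is the sign assigned at $w_2$ (resp. $w_{k-1}$); $W$ is an $(\alpha,\beta)$-ditrail if these are $\alpha,\beta$; the trivial ditrail $(v)$ counts as both a $(+,-)$- and a $(-,+)$-ditrail. $G$ is an $\alpha$-radial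 with root $r$ if every $v$ has an $(\alpha,-\alpha)$-ditrail from $v$ to $r$; it is almost strong if every $v\in V(G)\setminus\{r\}$ has a $(-\alpha,-\alpha)$-ditrail from $v$ to $r$, but $G$ has no $(-\alpha,-\alpha)$-ditrail closed over $r$. -}

module Defs where

open import Data.List using (List; []; _∷_; _++_; map)
open import Data.List.Membership.Propositional using (_∈_)
open import Data.List.Membership.Propositional.Properties using (∈-++⁺ˡ; ∈-++⁻)
open import Data.List.Relation.Unary.Unique.Propositional using (Unique)
open import Data.Product using (Σ; _×_; _,_; proj₁; proj₂)
open import Data.Sum using (_⊎_; inj₁; inj₂)
open import Data.Empty using (⊥)
open import Relation.Nullary using (¬_)
open import Relation.Binary.PropositionalEquality using (_≡_; _≢_)

data Sign : Set where
  plus minus : Sign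

neg : Sign → Sign
neg plus  = minus
neg minus = plus

-- Every edge e has (possibly identical) ends end₁ e, end₂ e and the maps
-- ∂ plus, ∂ minus : E → 2^V (as predicates) with the axioms of the paper.
-- Concrete (finite) bidirected graphs are finite sub-structures (below), so
-- that G₁ + G₂ (union of vertices and edges) makes sense.

record BiStructure (V E : Set) : Set₁ where
  field
    end₁ end₂ : E → V
    ∂         : Sign → E → V → Set
    ∂⊆        : ∀ α e x → ∂ α e x → x ≡ end₁ e ⊎ x ≡ end₂ e
    ∂∪₁       : ∀ e → ∂ plus e (end₁ e) ⊎ ∂ minus e (end₁ e)
    ∂∪₂       : ∀ e → ∂ plus e (end₂ e) ⊎ ∂ minus e (end₂ e)
    ∂disj     : ∀ e → end₁ e ≢ end₂ e → ∀ x → ∂ plus e x → ∂ minus e x → ⊥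

module Bidirected {V E : Set} (B : BiStructure V E) where
  open BiStructure B

  record Graph : Set where
    field
      vs     : List V
      es     : List E
      endsIn : ∀ {e} → e ∈ es → end₁ e ∈ vs × end₂ e ∈ vs
  open Graph public

  _+G_ : Graph → Graph → Graph
  G₁ +G G₂ = record
    { vs = vs G₁ ++ vs G₂
    ; es = es G₁ ++ es G₂
    ; endsIn = λ {e} e∈ → helper e (∈-++⁻ (es G₁) e∈)
    }
    where
      open import Data.List.Membership.Propositional.Properties using (∈-++⁺ʳ)
      helper : ∀ e → e ∈ es G₁ ⊎ e ∈ es G₂ → end₁ e ∈ vs G₁ ++ vs G₂ × end₂ e ∈ vs G₁ ++ vs G₂
      helper e (inj₁ p) = ∈-++⁺ˡ (proj₁ (endsIn G₁ p)) , ∈-++⁺ˡ (proj₂ (endsIn G₁ p))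
      helper e (inj₂ p) = ∈-++⁺ʳ (vs G₁) (proj₁ (endsIn G₂ p)) , ∈-++⁺ʳ (vs G₁) (proj₂ (endsIn G₂ p))

  MixedLoop : E → Set
  MixedLoop e = end₁ e ≡ end₂ e × ∂ plus e (end₁ e) × ∂ minus e (end₁ e)

  Trav : E → V → V → Sign → Sign → Set
  Trav e x y s t =
    ((x ≡ end₁ e × y ≡ end₂ e) ⊎ (x ≡ end₂ e × y ≡ end₁ e))
    × ∂ s e x × ∂ t e y × (MixedLoop e → s ≢ t)

  -- A walk (w₁, w₂, …, w_k) is represented by its first vertex w₁ together
  -- with the list of steps (w₂ , w₃), (w₄ , w₅), … (edge, next vertex).
  lastV : V → List (E × V) → V
  lastV x []            = x
  lastV x ((e , y) ∷ s) = lastV y s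

  edgesOf : List (E × V) → List E
  edgesOf = map proj₁

  -- Di x steps α β : the nontrivial walk starting at x with these steps is a
  -- diwalk, via a sign assignment giving w₁ sign α and w_k sign β over it.
  data Di : V → List (E × V) → Sign → Sign → Set where
    one  : ∀ {e x y s t} → Trav e x y s t → Di x ((e , y) ∷ []) s t
    cons : ∀ {e x y s t s' u rest} → Trav e x y s t → t ≢ s' →
           Di y rest s' u → Di x ((e , y) ∷ rest) s u

  data DiWalk (x : V) : List (E × V) → Sign → Sign → Set where
    triv₁   : DiWalk x [] plus minus
    triv₂   : DiWalk x [] minus plus
    nontriv : ∀ {steps α β} → Di x steps α β → DiWalk x steps α β

  DiTrail : Graph → Sign → Sign → V → V → Set
  DiTrail G α β x y =
    Σ (List (E × V)) λ steps →
      (∀ {e} → e ∈ edgesOf steps → e ∈ es G)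
      × Unique (edgesOf steps)
      × lastV x steps ≡ y
      × DiWalk x steps α β

  Radial : Sign → V → Graph → Set
  Radial α r G =
    r ∈ vs G × (∀ {v} → v ∈ vs G → DiTrail G α (neg α) v r)

  AlmostStrongRadial : Sign → V → Graph → Set
  AlmostStrongRadial α r G =
    Radial α r G
    × (∀ {v} → v ∈ vs G → v ≢ r → DiTrail G (neg α) (neg α) v r)
    × ¬ DiTrail G (neg α) (neg α) r r

-- The ditrails required of an almost strong radial in G₁ and in G₂ are
-- ditrails of G₁ + G₂ as well, so the substance of the lemma is that
-- G₁ + G₂ has no (−α,−α)-ditrail closed over r.  Because V(G₁) ∩ V(G₂) = {r},
-- each Gᵢ is "confined" in G₁ + G₂: an edge of G₁ + G₂ at a vertex of Gᵢ
-- other than r is an edge of Gᵢ.  Hence a diwalk whose first edge lies in Gᵢ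
-- stays in Gᵢ until it first returns to r.  At that return the signs of r
-- over the arriving and leaving edges differ, so one of them is −α: either
-- the segment up to the return is a closed (−α,−α)-ditrail inside Gᵢ
-- (impossible by hypothesis), or the remainder is a strictly shorter closed
-- (−α,−α)-ditrail of G₁ + G₂, and we recurse on its length.  Whether a
-- vertex equals r is not decidable, but since the goal is ⊥ we may argue
-- inside the double-negation monad, where excluded middle is available.
module Submission where

open import Defs
open import Data.List.Membership.Propositional using (_∈_)
open import Relation.Binary.PropositionalEquality using (_≡_)
open import Relation.Binary.PropositionalEquality
  using (refl; sym; cong; subst; _≢_; module ≡-Reasoning)
open import Data.List using (List; []; _∷_; _++_; length)
open import Data.List.Properties using (map-++; length-++-≤ʳ)
open import Data.List.Membership.Propositional.Properties
  using (∈-++⁺ˡ; ∈-++⁺ʳ; ∈-++⁻)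
open import Data.List.Relation.Unary.Any using (here; there)
import Data.List.Relation.Unary.All.Properties as All
open import Data.List.Relation.Unary.AllPairs using ([]; _∷_)
open import Data.List.Relation.Unary.Unique.Propositional using (Unique)
open import Data.Nat using (zero; suc; _≤_; _<_; s≤s)
open import Data.Nat.Properties using (≤-refl; ≤-pred; <-≤-trans)
open import Data.Product using (Σ; _×_; _,_; proj₁; proj₂)
open import Data.Sum using (_⊎_; inj₁; inj₂)
open import Data.Unit using (tt)
open import Data.Empty using (⊥; ⊥-elim)
open import Function using (_∘_)
open import Relation.Nullary using (¬_; yes; no; ¬¬-excluded-middle)
open import Relation.Nullary.Negation using (¬¬-map)

distinct-signs : ∀ {t s : Sign} → t ≢ s → ∀ (β : Sign) → t ≡ β ⊎ s ≡ β
distinct-signs {plus}  {plus}  t≢s _     = ⊥-elim (t≢s refl)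
distinct-signs {minus} {minus} t≢s _     = ⊥-elim (t≢s refl)
distinct-signs {plus}  {minus} _   plus  = inj₁ refl
distinct-signs {plus}  {minus} _   minus = inj₂ refl
distinct-signs {minus} {plus}  _   plus  = inj₂ refl
distinct-signs {minus} {plus}  _   minus = inj₁ refl

Unique-++ˡ : ∀ {A : Set} (xs : List A) {ys} → Unique (xs ++ ys) → Unique xs
Unique-++ˡ []       _                 = []
Unique-++ˡ (_ ∷ xs) (fresh ∷ unique) = All.++⁻ˡ xs fresh ∷ Unique-++ˡ xs unique

Unique-++ʳ : ∀ {A : Set} (xs : List A) {ys} → Unique (xs ++ ys) → Unique ys
Unique-++ʳ []       unique       = unique
Unique-++ʳ (_ ∷ xs) (_ ∷ unique) = Unique-++ʳ xs unique

module _ {V E : Set} (B : BiStructure V E) where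
  open Bidirected B

  InGraph : Graph → List (E × V) → Set
  InGraph H steps = ∀ {e} → e ∈ edgesOf steps → e ∈ es H

  DiTrail-mono : ∀ H H' {a b x y} → (∀ {e} → e ∈ es H → e ∈ es H') →
                 DiTrail H a b x y → DiTrail H' a b x y
  DiTrail-mono _ _ H⊆H' (steps , inH , unique , ends , walk) =
    steps , H⊆H' ∘ inH , unique , ends , walk

  lastV-++ : ∀ x p q → lastV x (p ++ q) ≡ lastV (lastV x p) q
  lastV-++ x []            q = refl
  lastV-++ x ((_ , y) ∷ p) q = lastV-++ y p q

  InGraph-++ʳ : ∀ H p {q} → InGraph H (p ++ q) → InGraph H q
  InGraph-++ʳ H p {q} inH e∈q =
    inH (subst (_ ∈_) (sym (map-++ proj₁ p q)) (∈-++⁺ʳ (edgesOf p) e∈q))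

  Unique-prefix : ∀ p q → Unique (edgesOf (p ++ q)) → Unique (edgesOf p)
  Unique-prefix p q unique = Unique-++ˡ (edgesOf p) (subst Unique (map-++ proj₁ p q) unique)

  Unique-suffix : ∀ p q → Unique (edgesOf (p ++ q)) → Unique (edgesOf q)
  Unique-suffix p q unique = Unique-++ʳ (edgesOf p) (subst Unique (map-++ proj₁ p q) unique)

  Di-suffix-shorter : ∀ {x p s t} q → Di x p s t → length q < length (p ++ q)
  Di-suffix-shorter {p = []}    q ()
  Di-suffix-shorter {p = _ ∷ p} q _ = s≤s (length-++-≤ʳ q {p})

  traversal-ends : ∀ H {e x y s t} → Trav e x y s t → e ∈ es H → x ∈ vs H × y ∈ vs H
  traversal-ends H (inj₁ (refl , refl) , _) e∈H = endsIn H e∈H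
  traversal-ends H (inj₂ (refl , refl) , _) e∈H =
    proj₂ (endsIn H e∈H) , proj₁ (endsIn H e∈H)

  first-traversal : ∀ {x e y rest s u} → Di x ((e , y) ∷ rest) s u → Σ Sign (Trav e x y s)
  first-traversal (one trav)      = _ , trav
  first-traversal (cons trav _ _) = _ , trav

  trivial-not-closed : ∀ {x} β → ¬ DiWalk x [] β β
  trivial-not-closed plus  (nontriv ())
  trivial-not-closed minus (nontriv ())

  module _ (r : V) where

    Confined : Graph → Graph → Set
    Confined U H = ∀ {e x y s t} → Trav e x y s t → e ∈ es U →
                   x ∈ vs H → x ≢ r → e ∈ es H

    confined-by-disjoint : ∀ U H H' → (∀ {e} → e ∈ es U → e ∈ es H ⊎ e ∈ es H') →
      (∀ v → v ∈ vs H → v ∈ vs H' → v ≡ r) → Confined U H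
    confined-by-disjoint U H H' split disjoint trav e∈U x∈H x≢r with split e∈U
    ... | inj₁ e∈H  = e∈H
    ... | inj₂ e∈H' = ⊥-elim (x≢r (disjoint _ x∈H (proj₁ (traversal-ends H' trav e∈H'))))

    -- What follows a return to r with sign `arrival`: either nothing (so the
    -- final sign u is the arrival sign) or a diwalk from r leaving with a
    -- sign different from the arrival sign.
    Continuation : Sign → List (E × V) → Sign → Set
    Continuation arrival suffix u =
      (suffix ≡ [] × arrival ≡ u) ⊎ Σ Sign λ s' → arrival ≢ s' × Di r suffix s' u

    record FirstReturn (H : Graph) (x : V) (steps : List (E × V)) (s u : Sign) : Set where
      field
        prefix suffix : List (E × V)
        split         : steps ≡ prefix ++ suffix
        prefix-in     : InGraph H prefix
        returns       : lastV x prefix ≡ r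
        arrival       : Sign
        prefix-walk   : Di x prefix s arrival
        continues     : Continuation arrival suffix u

    first-return : ∀ U H {x e y rest s u} → Confined U H → e ∈ es H →
      InGraph U rest → Di x ((e , y) ∷ rest) s u → lastV y rest ≡ r →
      ¬ ¬ FirstReturn H x ((e , y) ∷ rest) s u
    first-return U H _ e∈H _ (one trav) ends k = k record
      { prefix = _ ∷ [] ; suffix = [] ; split = refl
      ; prefix-in = λ { (here refl) → e∈H } ; returns = ends
      ; arrival = _ ; prefix-walk = one trav ; continues = inj₁ (refl , refl) }
    first-return U H {rest = []} _ _ _ (cons _ _ ()) _
    first-return U H {x} {e} {y} {(e' , y') ∷ rest'} {s} {u}
                 confined e∈H inU (cons {s' = s'} trav t≢s' walk) ends k =
      ¬¬-excluded-middle λ where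
        (yes y≡r) → k record
          { prefix = _ ∷ [] ; suffix = _ ; split = refl
          ; prefix-in = λ { (here refl) → e∈H } ; returns = y≡r
          ; arrival = _ ; prefix-walk = one trav
          ; continues = inj₂ (_ , t≢s' , subst (λ z → Di z _ _ _) y≡r walk) }
        (no y≢r) → ¬¬-map extend
          (first-return U H confined (next-in-H y≢r) (λ e∈ → inU (there e∈)) walk ends) k
      where
        next-in-H : y ≢ r → e' ∈ es H
        next-in-H y≢r = confined (proj₂ (first-traversal walk)) (inU (here refl))
                                 (proj₂ (traversal-ends H trav e∈H)) y≢r

        extend : FirstReturn H y ((e' , y') ∷ rest') s' u →
                 FirstReturn H x ((e , y) ∷ (e' , y') ∷ rest') s u
        extend fr = record
          { prefix = (e , y) ∷ prefix ; suffix = suffix ; split = cong (_ ∷_) split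
          ; prefix-in = λ { (here refl) → e∈H ; (there e∈) → prefix-in e∈ }
          ; returns = returns ; arrival = arrival
          ; prefix-walk = cons trav t≢s' prefix-walk ; continues = continues }
          where open FirstReturn fr

    closing-sign : ∀ α {arrival suffix} → Continuation arrival suffix (neg α) →
                   arrival ≡ neg α ⊎ Di r suffix (neg α) (neg α)
    closing-sign α (inj₁ (_ , arrival≡)) = inj₁ arrival≡
    closing-sign α {arrival} {suffix} (inj₂ (s' , arrival≢s' , walk)) =
      by-leaving-sign (distinct-signs arrival≢s' (neg α)) walk
      where
        by-leaving-sign : arrival ≡ neg α ⊎ s' ≡ neg α → Di r suffix s' (neg α) →
                          arrival ≡ neg α ⊎ Di r suffix (neg α) (neg α)
        by-leaving-sign (inj₁ arrival≡) _    = inj₁ arrival≡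
        by-leaving-sign (inj₂ refl)     walk = inj₂ walk

    record Piece (α : Sign) (U : Graph) (e : E) : Set where
      field
        graph     : Graph
        has-edge  : e ∈ es graph
        confined  : Confined U graph
        no-closed : ¬ DiTrail graph (neg α) (neg α) r r

    no-closed-ditrail : ∀ α {U} → (∀ {e} → e ∈ es U → Piece α U e) →
                        ¬ DiTrail U (neg α) (neg α) r r
    no-closed-ditrail α {U} cover ([] , _ , _ , _ , walk) = trivial-not-closed (neg α) walk
    no-closed-ditrail α {U} cover (steps , inU , unique , ends , nontriv walk) =
      closed-walks (length steps) ≤-refl walk inU unique ends
      where
        closed-walks : ∀ n {steps} → length steps ≤ n → Di r steps (neg α) (neg α) →
          InGraph U steps → Unique (edgesOf steps) → lastV r steps ≡ r → ⊥
        closed-walks zero    {_ ∷ _} () _ _ _ _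
        closed-walks (suc n) {(e , y) ∷ rest} len walk inU unique ends =
          first-return U graph confined has-edge (λ e∈ → inU (there e∈)) walk ends
            (after-return len inU unique ends)
          where
            open Piece (cover (inU (here refl)))

            after-return : ∀ {steps} → length steps ≤ suc n → InGraph U steps →
              Unique (edgesOf steps) → lastV r steps ≡ r →
              FirstReturn graph r steps (neg α) (neg α) → ⊥
            after-return len inU unique ends
              record { prefix = p ; suffix = q ; split = refl ; prefix-in = p-in
                     ; returns = p-ends ; prefix-walk = p-walk ; continues = cont }
              with closing-sign α cont
            ... | inj₁ refl = no-closed
                    (p , p-in , Unique-prefix p q unique , p-ends , nontriv p-walk)
            ... | inj₂ q-walk = closed-walks n
                    (≤-pred (<-≤-trans (Di-suffix-shorter q p-walk) len)) q-walk
                    (InGraph-++ʳ U p inU) (Unique-suffix p q unique) q-ends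
              where
                open ≡-Reasoning
                q-ends : lastV r q ≡ r
                q-ends = begin
                  lastV r q              ≡⟨ cong (λ z → lastV z q) (sym p-ends) ⟩
                  lastV (lastV r p) q    ≡⟨ sym (lastV-++ r p q) ⟩
                  lastV r (p ++ q)       ≡⟨ ends ⟩
                  r                      ∎

    union-trails : ∀ G₁ G₂ {a b} {C : V → Set} →
      (∀ {v} → v ∈ vs G₁ → C v → DiTrail G₁ a b v r) →
      (∀ {v} → v ∈ vs G₂ → C v → DiTrail G₂ a b v r) →
      ∀ {v} → v ∈ vs (G₁ +G G₂) → C v → DiTrail (G₁ +G G₂) a b v r
    union-trails G₁ G₂ trails₁ trails₂ v∈ c with ∈-++⁻ (vs G₁) v∈
    ... | inj₁ v∈G₁ = DiTrail-mono G₁ (G₁ +G G₂) ∈-++⁺ˡ (trails₁ v∈G₁ c)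
    ... | inj₂ v∈G₂ = DiTrail-mono G₂ (G₁ +G G₂) (∈-++⁺ʳ (es G₁)) (trails₂ v∈G₂ c)

lemma10p12 : {V E : Set} (B : BiStructure V E) (α : Sign) (r : V)
    (G₁ G₂ : Bidirected.Graph B) →
    Bidirected.AlmostStrongRadial B α r G₁ →
    Bidirected.AlmostStrongRadial B α r G₂ →
    (∀ v → v ∈ Bidirected.Graph.vs G₁ → v ∈ Bidirected.Graph.vs G₂ → v ≡ r) →
    r ∈ Bidirected.Graph.vs G₁ → r ∈ Bidirected.Graph.vs G₂ →
    Bidirected.AlmostStrongRadial B α r (Bidirected._+G_ B G₁ G₂)
lemma10p12 B α r G₁ G₂ ((r∈G₁ , radial₁) , strong₁ , closed₁)
                       ((_ , radial₂) , strong₂ , closed₂) disjoint _ _ =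
  (∈-++⁺ˡ r∈G₁ , (λ v∈ → union-trails B r G₁ G₂ (λ w _ → radial₁ w) (λ w _ → radial₂ w) v∈ tt))
  , union-trails B r G₁ G₂ strong₁ strong₂
  , no-closed-ditrail B r α cover
  where
    open Bidirected B
    cover : ∀ {e} → e ∈ es (G₁ +G G₂) → Piece B r α (G₁ +G G₂) e
    cover e∈ with ∈-++⁻ (es G₁) e∈
    ... | inj₁ e∈G₁ = record
      { graph = G₁ ; has-edge = e∈G₁ ; no-closed = closed₁
      ; confined = confined-by-disjoint B r (G₁ +G G₂) G₁ G₂ (∈-++⁻ (es G₁)) disjoint }
    ... | inj₂ e∈G₂ = record
      { graph = G₂ ; has-edge = e∈G₂ ; no-closed = closed₂
      ; confined = confined-by-disjoint B r (G₁ +G G₂) G₂ G₁ swapped-split (λ v v∈₂ v∈₁ → disjoint v v∈₁ v∈₂) }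
      where
        swapped-split : ∀ {e} → e ∈ es (G₁ +G G₂) → e ∈ es G₂ ⊎ e ∈ es G₁
        swapped-split e∈ with ∈-++⁻ (es G₁) e∈
        ... | inj₁ e∈₁ = inj₂ e∈₁
        ... | inj₂ e∈₂ = inj₁ e∈₂
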